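{- Let $\mathcal{F}$ be a 3-SAT formula with variables $x_1,\dots,x_n$ and clauses $Q_1,\dots,Q_s$, let $k\ge 1$ be an integer, and let $G_F$ be the graph constructed from $\mathcal{F}$ and $k$ as described in the context. For every clause $Q_j$, there exist two different vertices $x,y$ of the path $P(u_j^2,u_j^3)$ such that every vertex of $G_F$ distinguishing $x$ and $y$ lies in $V(P(u_j^2,u_j^3))$. Consequently, for any $k$-metric basis $S$ of $G_F$, $|S\cap V(P(u_j^2,u_j^3))|\ge k$.
   Context: For a connected graph $G$, a vertex $w$ distinguishes $u,v$ if $d_G(u,w)\ne d_G(v,w)$. A set $S\subseteq V(G)$ is a $k$-metric generator if every pair of different vertices is distinguished by at least $k$ elements of $S$; a minimum-cardinality one is a $k$-metric basis, with cardinality $\dim_k(G)$. Construction of $G_F$ (each clause consists of three literals, a literal being $x_i$ or $\overline{x_i}$): (1) For every variable $x_i$ take a cycle $C^i$ of order $4\lceil k/2\rceil+2$ and let $T_i$ and $F_i$ be two diametral (antipodal) vertices of $C^i$. (2) For every clause $Q_j$ take a star $S_{1,4}$ with center $u_j$ and leaves $u_j^1,u_j^2,u_j^3,u_j^4$; if $k\ge 3$, subdivide the edge $u_ju_j^2$ so that the $u_j$–$u_j^2$ path has $\lceil k/2\rceil+1$ vertices and subdivide the edge $u_ju_j^3$ so that the $u_j$–$u_j^3$ path has $\lfloor k/2\rfloor+1$ vertices; $P(u_j^2,u_j^3)$ denotes the resulting $u_j^2$–$u_j^3$ path (through $u_j$). (3) If $x_i$ occurs as a positive literal in $Q_j$,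 add edges $T_iu_j^1$, $F_iu_j^1$, $F_iu_j^4$. (4) If $x_i$ occurs as a negative literal in $Q_j$, add edges $T_iu_j^1$, $F_iu_j^1$, $T_iu_j^4$. (5) For every $l$ such that neither $x_l$ nor $\overline{x_l}$ occurs in $Q_j$, add edges $T_lu_j^1$, $T_lu_j^4$, $F_lu_j^1$, $F_lu_j^4$. -}

module Defs where

open import Level using (0ℓ)
open import Data.Nat using (ℕ; zero; suc; _+_; _*_; _∸_; _≤_; ⌈_/2⌉; ⌊_/2⌋)
open import Data.Nat using () renaming (_<ᵇ_ to _<ᵇ_)
open import Data.Bool using (if_then_else_)
open import Data.Fin using (Fin; toℕ)
open import Data.Vec using (Vec)
import Data.Vec.Membership.Propositional as VM
open import Data.List using (List; length)
import Data.List.Membership.Propositional as LM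
open import Data.List.Relation.Unary.All using (All)
open import Data.List.Relation.Unary.Unique.Propositional using (Unique)
open import Data.Product using (Σ; ∃; ∃₂; _×_; _,_)
open import Data.Sum using (_⊎_)
open import Relation.Binary.PropositionalEquality using (_≡_; _≢_)
open import Relation.Nullary using (¬_)

record Graph : Set₁ where
  field
    V   : Set
    Adj : V → V → Set
open Graph public

data Walk (G : Graph) : V G → V G → ℕ → Set where
  here : ∀ {u} → Walk G u u 0
  step : ∀ {u w v d} → Adj G u w → Walk G w v d → Walk G u v (suc d)

IsDist : (G : Graph) → V G → V G → ℕ → Set
IsDist G u v d = Walk G u v d × (∀ d' → Walk G u v d' → d ≤ d')

Distinguishes : (G : Graph) → V G → V G → V G → Set
Distinguishes G u v w =
  ∃₂ λ d₁ d₂ → IsDist G u w d₁ × IsDist G v w d₂ × d₁ ≢ d₂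

-- S (a duplicate-free list, i.e. a finite set) contains at least k
-- distinct elements satisfying P
AtLeast : {A : Set} → ℕ → (A → Set) → List A → Set
AtLeast {A} k P S =
  ∃ λ (T : List A) → Unique T × All (LM._∈ S) T × All P T × k ≤ length T

IsKMetricGenerator : (G : Graph) → ℕ → List (V G) → Set
IsKMetricGenerator G k S =
  Unique S × (∀ u v → u ≢ v → AtLeast k (Distinguishes G u v) S)

IsKMetricBasis : (G : Graph) → ℕ → List (V G) → Set
IsKMetricBasis G k S =
  IsKMetricGenerator G k S ×
  (∀ S' → IsKMetricGenerator G k S' → length S ≤ length S')

data Literal (n : ℕ) : Set where
  pos neg : Fin n → Literal n

Clause : ℕ → Set
Clause n = Vec (Literal n) 3

-- formula with variables x_0..x_{n-1} and clauses Q_0..Q_{s-1}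
Formula : ℕ → ℕ → Set
Formula n s = Fin s → Clause n

Occurs : ∀ {n s} → Formula n s → Fin n → Fin s → Set
Occurs F i j = (pos i VM.∈ F j) ⊎ (neg i VM.∈ F j)

cycOrder : ℕ → ℕ
cycOrder k = 2 + 4 * ⌈ k /2⌉

-- T_i is vertex 0 of C^i, F_i is the antipodal vertex 2⌈k/2⌉+1
IsT : (k : ℕ) → Fin (cycOrder k) → Set
IsT k p = toℕ p ≡ 0

IsF : (k : ℕ) → Fin (cycOrder k) → Set
IsF k p = toℕ p ≡ suc (2 * ⌈ k /2⌉)

-- number of vertices of the u_j – u_j^2 path, resp. u_j – u_j^3 path
aLen bLen : ℕ → ℕ
aLen k = if k <ᵇ 3 then 2 else suc ⌈ k /2⌉
bLen k = if k <ᵇ 3 then 2 else suc ⌊ k /2⌋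

-- P(u_j^2,u_j^3) has vertices 0..pathOrder k - 1 : position 0 is u_j^2,
-- position hub k is u_j, last position is u_j^3
pathOrder : ℕ → ℕ
pathOrder k = aLen k + bLen k ∸ 1

hub : ℕ → ℕ
hub k = aLen k ∸ 1

data Vertex (n s k : ℕ) : Set where
  cyc : Fin n → Fin (cycOrder k) → Vertex n s k
  pth : Fin s → Fin (pathOrder k) → Vertex n s k
  u1  : Fin s → Vertex n s k
  u4  : Fin s → Vertex n s k

data Edge {n s : ℕ} (F : Formula n s) (k : ℕ) : Vertex n s k → Vertex n s k → Set where
  cycStep : ∀ i p q → toℕ q ≡ suc (toℕ p) → Edge F k (cyc i p) (cyc i q)
  cycWrap : ∀ i p q → toℕ p ≡ suc (4 * ⌈ k /2⌉) → toℕ q ≡ 0 → Edge F k (cyc i p) (cyc i q)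
  pathStep : ∀ j p q → toℕ q ≡ suc (toℕ p) → Edge F k (pth j p) (pth j q)
  star1 : ∀ j p → toℕ p ≡ hub k → Edge F k (pth j p) (u1 j)
  star4 : ∀ j p → toℕ p ≡ hub k → Edge F k (pth j p) (u4 j)
  posT1 : ∀ i j p → pos i VM.∈ F j → IsT k p → Edge F k (cyc i p) (u1 j)
  posF1 : ∀ i j p → pos i VM.∈ F j → IsF k p → Edge F k (cyc i p) (u1 j)
  posF4 : ∀ i j p → pos i VM.∈ F j → IsF k p → Edge F k (cyc i p) (u4 j)
  negT1 : ∀ i j p → neg i VM.∈ F j → IsT k p → Edge F k (cyc i p) (u1 j)
  negF1 : ∀ i j p → neg i VM.∈ F j → IsF k p → Edge F k (cyc i p) (u1 j)
  negT4 : ∀ i j p → neg i VM.∈ F j → IsT k p → Edge F k (cyc i p) (u4 j)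
  absT1 : ∀ i j p → ¬ Occurs F i j → IsT k p → Edge F k (cyc i p) (u1 j)
  absT4 : ∀ i j p → ¬ Occurs F i j → IsT k p → Edge F k (cyc i p) (u4 j)
  absF1 : ∀ i j p → ¬ Occurs F i j → IsF k p → Edge F k (cyc i p) (u1 j)
  absF4 : ∀ i j p → ¬ Occurs F i j → IsF k p → Edge F k (cyc i p) (u4 j)

G_F : ∀ {n s} → Formula n s → ℕ → Graph
G_F {n} {s} F k = record
  { V = Vertex n s k
  ; Adj = λ u v → Edge F k u v ⊎ Edge F k v u }

data InP {n s k : ℕ} (j : Fin s) : Vertex n s k → Set where
  inP : ∀ p → InP j (pth j p)

-- u_j separates P(u_j^2,u_j^3) from the rest of G_F: a walk from a vertex of
-- the path to a vertex outside it must pass through u_j.  Hence the two path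
-- neighbours x, y of u_j satisfy d(x,w) = 1 + d(u_j,w) = d(y,w) for every w
-- outside the path, so only path vertices distinguish them, and a k-metric
-- generator must contain k such vertices.
module Submission where

open import Defs
open import Data.Nat using (ℕ; suc; _≤_; _<_; s≤s)
import Data.Nat as ℕ
open import Data.Nat.Properties using (≤-trans; <-trans; ≤-antisym; <⇒≢; n<1+n; m<n⇒m<1+n; m≤m+n; +-suc)
open import Data.Fin using (Fin; toℕ; fromℕ<)
import Data.Fin as Fin
open import Data.Fin.Properties using (toℕ-fromℕ<)
open import Data.Product using (Σ; _×_; _,_)
open import Data.Sum using (inj₁; inj₂)
open import Data.Empty using (⊥-elim)
open import Data.List.Relation.Unary.All as All using ()
open import Relation.Nullary using (¬_; Dec; yes; no)
open import Relation.Nullary.Decidable using (decidable-stable)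
open import Relation.Binary.PropositionalEquality using (_≡_; _≢_; refl; sym; trans; cong; subst)

module _ (G : Graph) where

  ReachesNoLater : V G → V G → V G → Set
  ReachesNoLater y x w = ∀ {d} → Walk G x w d → Σ ℕ λ d′ → Walk G y w d′ × d′ ≤ d

  dist-mono : ∀ {x y w d₁ d₂} → ReachesNoLater y x w →
              IsDist G x w d₁ → IsDist G y w d₂ → d₂ ≤ d₁
  dist-mono y≼x (W₁ , _) (_ , minimal₂) with y≼x W₁
  ... | d′ , W , d′≤d₁ = ≤-trans (minimal₂ d′ W) d′≤d₁

  ¬distinguishes : ∀ {x y w} → ReachesNoLater y x w → ReachesNoLater x y w →
                   ¬ Distinguishes G x y w
  ¬distinguishes y≼x x≼y (_ , _ , D₁ , D₂ , d₁≢d₂) =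
    d₁≢d₂ (≤-antisym (dist-mono x≼y D₂ D₁) (dist-mono y≼x D₁ D₂))

  generator-atLeast : ∀ {k x y} {P : V G → Set} {S} → x ≢ y →
                      (∀ w → Distinguishes G x y w → P w) →
                      IsKMetricGenerator G k S → AtLeast k P S
  generator-atLeast {x = x} {y} x≢y only (_ , generates) with generates x y x≢y
  ... | T , unique , T⊆S , distinguishers , k≤|T| =
    T , unique , T⊆S , All.map (only _) distinguishers , k≤|T|

InP? : ∀ {n s k} (j : Fin s) (w : Vertex n s k) → Dec (InP j w)
InP? j (pth j′ p) with j′ Fin.≟ j
... | yes refl = yes (inP p)
... | no j′≢j = no λ { (inP _) → j′≢j refl }
InP? j (cyc _ _) = no λ ()
InP? j (u1 _) = no λ ()
InP? j (u4 _) = no λ ()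

2+a<1+a+2+b : ∀ a b → suc (suc a) < suc a ℕ.+ suc (suc b)
2+a<1+a+2+b a b = s≤s (subst (suc (suc a) ≤_) (sym a+2+b≡2+a+b) (s≤s (s≤s (m≤m+n a b))))
  where
  a+2+b≡2+a+b : a ℕ.+ suc (suc b) ≡ suc (suc (a ℕ.+ b))
  a+2+b≡2+a+b = trans (+-suc a (suc b)) (cong suc (+-suc a b))

hub-interior : ∀ k → Σ ℕ λ a → hub k ≡ suc a × suc (suc a) < pathOrder k
hub-interior 0 = 0 , refl , 2+a<1+a+2+b 0 0
hub-interior 1 = 0 , refl , 2+a<1+a+2+b 0 0
hub-interior 2 = 0 , refl , 2+a<1+a+2+b 0 0
hub-interior (suc (suc (suc m))) = _ , refl , 2+a<1+a+2+b _ _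

module _ {n s : ℕ} (F : Formula n s) (k : ℕ) (j : Fin s) where
  private
    G : Graph
    G = G_F F k

  HubWalkShorterThan : Vertex n s k → ℕ → Set
  HubWalkShorterThan w d =
    Σ (Fin (pathOrder k)) λ c → toℕ c ≡ hub k × Σ ℕ λ d′ → Walk G (pth j c) w d′ × d′ < d

  walk-leaving-path-via-hub : ∀ {p w d} → ¬ InP j w → toℕ p ≢ hub k →
                              Walk G (pth j p) w d → HubWalkShorterThan w d
  walk-after-path-step : ∀ {q w d} → ¬ InP j w →
                         Walk G (pth j q) w d → HubWalkShorterThan w (suc d)

  walk-leaving-path-via-hub {p} w∉P _ here = ⊥-elim (w∉P (inP p))
  walk-leaving-path-via-hub w∉P _ (step (inj₁ (pathStep _ _ _ _)) W) = walk-after-path-step w∉P W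
  walk-leaving-path-via-hub w∉P _ (step (inj₂ (pathStep _ _ _ _)) W) = walk-after-path-step w∉P W
  walk-leaving-path-via-hub _ p≢hub (step (inj₁ (star1 _ _ p≡hub)) _) = ⊥-elim (p≢hub p≡hub)
  walk-leaving-path-via-hub _ p≢hub (step (inj₁ (star4 _ _ p≡hub)) _) = ⊥-elim (p≢hub p≡hub)

  walk-after-path-step {q} w∉P W with toℕ q ℕ.≟ hub k
  ... | yes q≡hub = q , q≡hub , _ , W , n<1+n _
  ... | no q≢hub with walk-leaving-path-via-hub w∉P q≢hub W
  ...   | c , c≡hub , d′ , W′ , d′<d = c , c≡hub , d′ , W′ , m<n⇒m<1+n d′<d

  hub-neighbour-reaches-no-later :
    ∀ {x y w} → ¬ InP j w → toℕ x ≢ hub k →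
    (∀ c → toℕ c ≡ hub k → Adj G (pth j y) (pth j c)) →
    ReachesNoLater G (pth j y) (pth j x) w
  hub-neighbour-reaches-no-later w∉P x≢hub y~hub W
    with walk-leaving-path-via-hub w∉P x≢hub W
  ... | c , c≡hub , d′ , W′ , d′<d = suc d′ , step (y~hub c c≡hub) W′ , d′<d

  only-path-distinguishes-hub-neighbours :
    ∀ {x y} → suc (toℕ x) ≡ hub k → toℕ y ≡ suc (hub k) →
    ∀ w → Distinguishes G (pth j x) (pth j y) w → InP j w
  only-path-distinguishes-hub-neighbours {x} {y} 1+x≡hub y≡1+hub w D =
    decidable-stable (InP? j w) λ w∉P →
      ¬distinguishes G (hub-neighbour-reaches-no-later w∉P x≢hub y~hub)
                       (hub-neighbour-reaches-no-later w∉P y≢hub x~hub) D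
    where
    x≢hub : toℕ x ≢ hub k
    x≢hub x≡hub = <⇒≢ (n<1+n (toℕ x)) (trans x≡hub (sym 1+x≡hub))
    y≢hub : toℕ y ≢ hub k
    y≢hub y≡hub = <⇒≢ (n<1+n (hub k)) (trans (sym y≡hub) y≡1+hub)
    x~hub : ∀ c → toℕ c ≡ hub k → Adj G (pth j x) (pth j c)
    x~hub c c≡hub = inj₁ (pathStep j x c (trans c≡hub (sym 1+x≡hub)))
    y~hub : ∀ c → toℕ c ≡ hub k → Adj G (pth j y) (pth j c)
    y~hub c c≡hub = inj₂ (pathStep j c y (trans y≡1+hub (cong suc (sym c≡hub))))

hub-neighbours : ∀ k → Σ (Fin (pathOrder k)) λ x → Σ (Fin (pathOrder k)) λ y →
                 suc (toℕ x) ≡ hub k × toℕ y ≡ suc (hub k)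
hub-neighbours k with hub-interior k
... | a , hub≡1+a , 2+a<order =
  fromℕ< (<-trans (n<1+n a) (<-trans (n<1+n (suc a)) 2+a<order)) ,
  fromℕ< 2+a<order ,
  trans (cong suc (toℕ-fromℕ< _)) (sym hub≡1+a) ,
  trans (toℕ-fromℕ< _) (cong suc (sym hub≡1+a))

mainTheorem4 : ∀ {n s : ℕ} (F : Formula n s) (k : ℕ) → 1 ≤ k → (j : Fin s) →
    Σ (Vertex n s k) (λ x → Σ (Vertex n s k) (λ y →
      x ≢ y × InP j x × InP j y ×
      (∀ w → Distinguishes (G_F F k) x y w → InP j w)))
    × (∀ S → IsKMetricBasis (G_F F k) k S → AtLeast k (InP j) S)
mainTheorem4 F k _ j with hub-neighbours k
... | x , y , 1+x≡hub , y≡1+hub =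
  (pth j x , pth j y , x≢y , inP x , inP y , only-path-distinguishes) ,
  λ S (generator , _) → generator-atLeast (G_F F k) x≢y only-path-distinguishes generator
  where
  only-path-distinguishes : ∀ w → Distinguishes (G_F F k) (pth j x) (pth j y) w → InP j w
  only-path-distinguishes = only-path-distinguishes-hub-neighbours F k j 1+x≡hub y≡1+hub
  x≢y : pth j x ≢ pth j y
  x≢y refl = <⇒≢ (m<n⇒m<1+n (n<1+n (toℕ x))) (trans y≡1+hub (cong suc (sym 1+x≡hub)))
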